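{- Let $(F_n)_{n\ge 0}$ be the Fibonacci numbers. For every integer $m\ge 2$ the following identities hold: \begin{align*} &\left( \sum_{k=1}^{2m - 1} (-1)^{k-1} F_k^3\right) F_{2m-1}^3 + \left( \sum_{k=2}^{2m-2} F_{k}^3 \right) F_{2m}^3 \ = \ \frac{(F_{2m-1}^3 - 1) (F_{2m}^3 - 1)}{2}, \\ &1 + \left( \sum_{k=1}^{2m} (-1)^{k} F_k^3 - 1\right) F_{2m}^3 + \left( \sum_{k=2}^{2m-1} F_{k}^3 \right) F_{2m+1}^3 \ = \ \frac{(F_{2m}^3 - 1) (F_{2m+1}^3 - 1)}{2}. \end{align*}
   Context: The Fibonacci numbers are defined by $F_0=0$, $F_1=1$, and $F_n=F_{n-1}+F_{n-2}$ for $n\ge 2$. -}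

module Defs where

open import Data.Nat using (ℕ; zero; suc)
open import Data.Integer using (ℤ; +_; _+_; _*_; -_; _^_)

fib : ℕ → ℕ
fib zero = 0
fib (suc zero) = 1
fib (suc (suc n)) = fib (suc n) Data.Nat.+ fib n

F : ℕ → ℤ
F n = + fib n

sgn : ℕ → ℤ
sgn zero = + 1
sgn (suc k) = - sgn k

-- ∑_{k=a}^{b} f k  (a sum over k = a, a+1, …, b; empty if b < a)
-- defined as ∑_{i=0}^{n-1} f (a + i) with n = (b + 1) ∸ a
sumFrom : ℕ → ℕ → (ℕ → ℤ) → ℤ
sumFrom a zero f = + 0
sumFrom a (suc n) f = f a + sumFrom (suc a) n f

∑[_,_] : ℕ → ℕ → (ℕ → ℤ) → ℤ
∑[ a , b ] f = sumFrom a (suc b Data.Nat.∸ a) f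

-- Both sums have polynomial closed forms in a pair of consecutive Fibonacci numbers
-- (x, y) = (F n, F (n+1)).  The shift T (x, y) = (y, x + y) has eigenvalues φ, ψ with
-- φψ = −1, so no nonzero homogeneous form of odd degree is T-invariant and the
-- difference equations  G ∘ T − G = 2 C y³  (C = y² − xy − x², which equals (−1)ⁿ by
-- Cassini, turning the alternating summand into a quintic form) and  H ∘ T − H = 2 y³
-- have unique homogeneous solutions G (degree 5) and H (degree 3).  Substituting these
-- closed forms, each identity of the theorem becomes a polynomial identity in
-- (F (n−1), F n) that holds modulo C ∓ 1, which Cassini supplies.
module Submission where

open import Defs
open import Data.Nat using (ℕ; zero; suc; _≤_; _∸_; s≤s; z≤n)
open import Data.Nat.Properties using (+-identityʳ; +-suc; +-comm; *-suc; *-distribˡ-∸; *-monoʳ-≤; ∸-monoˡ-≤; ≤-trans)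
open import Data.Integer using (ℤ; +_; -1ℤ; _+_; _-_; _*_; -_; _^_)
open import Data.Integer.Properties using (pos-+; neg-involutive; neg-distribˡ-*; neg-distribʳ-*; neg-distrib-+; +-inverseʳ; *-zeroʳ; *-distribˡ-+)
import Data.Integer.Properties as ℤ
open import Data.Integer.Tactic.RingSolver using (solve-∀)
open import Data.Product using (_×_; _,_)
open import Relation.Binary.PropositionalEquality using (_≡_; refl; sym; trans; cong; cong₂)
open Relation.Binary.PropositionalEquality.≡-Reasoning

F-suc-suc : ∀ n → F (suc (suc n)) ≡ F n + F (suc n)
F-suc-suc n = trans (pos-+ (fib (suc n)) (fib n)) (ℤ.+-comm (F (suc n)) (F n))

sgn-even : ∀ k → sgn (2 Data.Nat.* k) ≡ + 1
sgn-even zero    = refl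
sgn-even (suc k) = begin
  sgn (2 Data.Nat.* suc k)         ≡⟨ cong sgn (*-suc 2 k) ⟩
  sgn (suc (suc (2 Data.Nat.* k))) ≡⟨ neg-involutive (sgn (2 Data.Nat.* k)) ⟩
  sgn (2 Data.Nat.* k)             ≡⟨ sgn-even k ⟩
  + 1                              ∎

sumFrom-telescope : ∀ (c : ℤ) (f Φ : ℕ → ℤ) → (∀ k → c * f (suc k) ≡ Φ (suc k) - Φ k) →
                    ∀ a n → c * sumFrom (suc a) n f ≡ Φ (a Data.Nat.+ n) - Φ a
sumFrom-telescope c f Φ step a zero = begin
  c * + 0                     ≡⟨ *-zeroʳ c ⟩
  + 0                         ≡⟨ sym (+-inverseʳ (Φ a)) ⟩
  Φ a - Φ a                   ≡⟨ cong (λ i → Φ i - Φ a) (sym (+-identityʳ a)) ⟩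
  Φ (a Data.Nat.+ 0) - Φ a    ∎
sumFrom-telescope c f Φ step a (suc n) = begin
  c * (f (suc a) + sumFrom (suc (suc a)) n f)          ≡⟨ *-distribˡ-+ c (f (suc a)) _ ⟩
  c * f (suc a) + c * sumFrom (suc (suc a)) n f        ≡⟨ cong₂ _+_ (step a) (sumFrom-telescope c f Φ step (suc a) n) ⟩
  (Φ (suc a) - Φ a) + (Φ (suc a Data.Nat.+ n) - Φ (suc a)) ≡⟨ cancel (Φ a) (Φ (suc a)) (Φ (suc a Data.Nat.+ n)) ⟩
  Φ (suc a Data.Nat.+ n) - Φ a                         ≡⟨ cong (λ i → Φ i - Φ a) (sym (+-suc a n)) ⟩
  Φ (a Data.Nat.+ suc n) - Φ a                         ∎
  where
  cancel : ∀ p q r → (q - p) + (r - q) ≡ r - p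
  cancel = solve-∀

cassiniForm : ℤ → ℤ → ℤ
cassiniForm x y = y * y - x * y - x * x

altCubePotential : ℤ → ℤ → ℤ
altCubePotential x y =
  y * y * y * y * y - x * y * y * y * y - + 4 * x * x * y * y * y
  + + 2 * x * x * x * y * y + + 4 * x * x * x * x * y + x * x * x * x * x

cubePotential : ℤ → ℤ → ℤ
cubePotential x y = + 3 * x * y * y - y * y * y - x * x * x

-- solve-∀ neither unfolds definitions nor understands _^_, so each polynomial identity
-- is proved in an unfolded form, definitionally equal to the stated one.
cassiniForm-shift : ∀ x y → cassiniForm y (x + y) ≡ - cassiniForm x y
cassiniForm-shift = unfolded
  where
  unfolded : ∀ x y → let C = λ x y → y * y - x * y - x * x in C y (x + y) ≡ - C x y
  unfolded = solve-∀

altCubePotential-shift : ∀ w x → + 2 * (cassiniForm w x * x ^ 3) ≡ altCubePotential x (w + x) - altCubePotential w x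
altCubePotential-shift = unfolded
  where
  unfolded : ∀ w x →
    let C = λ x y → y * y - x * y - x * x
        G = λ x y → y * y * y * y * y - x * y * y * y * y - + 4 * x * x * y * y * y
                    + + 2 * x * x * x * y * y + + 4 * x * x * x * x * y + x * x * x * x * x
    in + 2 * (C w x * (x * (x * (x * + 1)))) ≡ G x (w + x) - G w x
  unfolded = solve-∀

cubePotential-shift : ∀ w x → + 2 * x ^ 3 ≡ cubePotential x (w + x) - cubePotential w x
cubePotential-shift = unfolded
  where
  unfolded : ∀ w x →
    let H = λ x y → + 3 * x * y * y - y * y * y - x * x * x
    in + 2 * (x * (x * (x * + 1))) ≡ H x (w + x) - H w x
  unfolded = solve-∀

cassini : ∀ n → cassiniForm (F n) (F (suc n)) ≡ sgn n
cassini zero    = refl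
cassini (suc n) = begin
  cassiniForm (F (suc n)) (F (suc (suc n))) ≡⟨ cong (cassiniForm (F (suc n))) (F-suc-suc n) ⟩
  cassiniForm (F (suc n)) (F n + F (suc n)) ≡⟨ cassiniForm-shift (F n) (F (suc n)) ⟩
  - cassiniForm (F n) (F (suc n))           ≡⟨ cong -_ (cassini n) ⟩
  - sgn n                                   ∎

altCubePotentialAt : ℕ → ℤ
altCubePotentialAt n = altCubePotential (F n) (F (suc n))

cubePotentialAt : ℕ → ℤ
cubePotentialAt n = cubePotential (F n) (F (suc n))

altCubes-step : ∀ k → + 2 * (sgn k * F (suc k) ^ 3) ≡ altCubePotentialAt (suc k) - altCubePotentialAt k
altCubes-step k = begin
  + 2 * (sgn k * x ^ 3)                              ≡⟨ cong (λ e → + 2 * (e * x ^ 3)) (sym (cassini k)) ⟩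
  + 2 * (cassiniForm w x * x ^ 3)                    ≡⟨ altCubePotential-shift w x ⟩
  altCubePotential x (w + x) - altCubePotential w x  ≡⟨ cong (λ y → altCubePotential x y - altCubePotential w x) (sym (F-suc-suc k)) ⟩
  altCubePotentialAt (suc k) - altCubePotentialAt k  ∎
  where
  w = F k
  x = F (suc k)

signedCubes-step : ∀ k → + 2 * (sgn (suc k) * F (suc k) ^ 3) ≡ - altCubePotentialAt (suc k) - - altCubePotentialAt k
signedCubes-step k = begin
  + 2 * (- sgn k * F (suc k) ^ 3)   ≡⟨ cong (+ 2 *_) (sym (neg-distribˡ-* (sgn k) _)) ⟩
  + 2 * - (sgn k * F (suc k) ^ 3)   ≡⟨ sym (neg-distribʳ-* (+ 2) _) ⟩
  - (+ 2 * (sgn k * F (suc k) ^ 3)) ≡⟨ cong -_ (altCubes-step k) ⟩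
  - (altCubePotentialAt (suc k) - altCubePotentialAt k) ≡⟨ neg-distrib-+ (altCubePotentialAt (suc k)) _ ⟩
  - altCubePotentialAt (suc k) - - altCubePotentialAt k ∎

cubes-step : ∀ k → + 2 * F (suc k) ^ 3 ≡ cubePotentialAt (suc k) - cubePotentialAt k
cubes-step k = trans (cubePotential-shift (F k) (F (suc k)))
                     (cong (λ y → cubePotential (F (suc k)) y - cubePotentialAt k) (sym (F-suc-suc k)))

altCubeSum : ∀ n → + 2 * sumFrom 1 n (λ k → sgn (k ∸ 1) * F k ^ 3) ≡ altCubePotentialAt n - + 1
altCubeSum = sumFrom-telescope (+ 2) _ altCubePotentialAt altCubes-step 0

signedCubeSum : ∀ n → + 2 * sumFrom 1 n (λ k → sgn k * F k ^ 3) ≡ - altCubePotentialAt n + + 1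
signedCubeSum = sumFrom-telescope (+ 2) _ (λ n → - altCubePotentialAt n) signedCubes-step 0

cubeSum : ∀ a n → + 2 * sumFrom (suc a) n (λ k → F k ^ 3) ≡ cubePotentialAt (a Data.Nat.+ n) - cubePotentialAt a
cubeSum = sumFrom-telescope (+ 2) _ cubePotentialAt cubes-step

firstIdentity-polynomial : ∀ w x → cassiniForm w x ≡ + 1 →
  (altCubePotential x (w + x) - + 1) * x ^ 3 + (cubePotential w x - + 1) * (w + x) ^ 3
    ≡ (x ^ 3 - + 1) * ((w + x) ^ 3 - + 1)
firstIdentity-polynomial w x C≡1 = begin
  (altCubePotential x y - + 1) * x ^ 3 + (cubePotential w x - + 1) * y ^ 3 ≡⟨ unfolded w x ⟩
  rhs + ((+ 1 - C) * (x ^ 3 * K) + (C ^ 3 - + 1))                           ≡⟨ cong (λ c → rhs + ((+ 1 - c) * (x ^ 3 * K) + (c ^ 3 - + 1))) C≡1 ⟩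
  rhs + + 0                                                                  ≡⟨ ℤ.+-identityʳ rhs ⟩
  rhs                                                                        ∎
  where
  y = w + x
  C = cassiniForm w x
  K = y ^ 3 - + 3 * x * x * y - x ^ 3
  rhs = (x ^ 3 - + 1) * (y ^ 3 - + 1)
  unfolded : ∀ w x →
    let cube = λ z → z * (z * (z * + 1))
        C = λ x y → y * y - x * y - x * x
        G = λ x y → y * y * y * y * y - x * y * y * y * y - + 4 * x * x * y * y * y
                    + + 2 * x * x * x * y * y + + 4 * x * x * x * x * y + x * x * x * x * x
        H = λ x y → + 3 * x * y * y - y * y * y - x * x * x
        y = w + x
    in (G x y - + 1) * cube x + (H w x - + 1) * cube y
       ≡ (cube x - + 1) * (cube y - + 1)
         + ((+ 1 - C w x) * (cube x * (cube y - + 3 * x * x * y - cube x)) + (cube (C w x) - + 1))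
  unfolded = solve-∀

secondIdentity-polynomial : ∀ w x → cassiniForm w x ≡ -1ℤ →
  + 2 + (- altCubePotential x (w + x) + + 1 - + 2) * x ^ 3 + (cubePotential w x - + 1) * (w + x) ^ 3
    ≡ (x ^ 3 - + 1) * ((w + x) ^ 3 - + 1)
secondIdentity-polynomial w x C≡-1 = begin
  + 2 + (- altCubePotential x y + + 1 - + 2) * x ^ 3 + (cubePotential w x - + 1) * y ^ 3 ≡⟨ unfolded w x ⟩
  rhs + ((+ 1 + C) * (x ^ 3 * K) + (C ^ 3 + + 1))                                        ≡⟨ cong (λ c → rhs + ((+ 1 + c) * (x ^ 3 * K) + (c ^ 3 + + 1))) C≡-1 ⟩
  rhs + + 0                                                                               ≡⟨ ℤ.+-identityʳ rhs ⟩
  rhs                                                                                     ∎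
  where
  y = w + x
  C = cassiniForm w x
  K = y ^ 3 - + 3 * x * x * y - x ^ 3
  rhs = (x ^ 3 - + 1) * (y ^ 3 - + 1)
  unfolded : ∀ w x →
    let cube = λ z → z * (z * (z * + 1))
        C = λ x y → y * y - x * y - x * x
        G = λ x y → y * y * y * y * y - x * y * y * y * y - + 4 * x * x * y * y * y
                    + + 2 * x * x * x * y * y + + 4 * x * x * x * x * y + x * x * x * x * x
        H = λ x y → + 3 * x * y * y - y * y * y - x * x * x
        y = w + x
    in + 2 + (- G x y + + 1 - + 2) * cube x + (H w x - + 1) * cube y
       ≡ (cube x - + 1) * (cube y - + 1)
         + ((+ 1 + C w x) * (cube x * (cube y - + 3 * x * x * y - cube x)) + (cube (C w x) + + 1))
  unfolded = solve-∀

firstIdentity-algebraic : ∀ w x {y q s} → y ≡ w + x → cassiniForm w x ≡ + 1 →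
  + 2 * q ≡ altCubePotential x y - + 1 → + 2 * s ≡ cubePotential w x - + 1 →
  + 2 * (q * x ^ 3 + s * y ^ 3) ≡ (x ^ 3 - + 1) * (y ^ 3 - + 1)
firstIdentity-algebraic w x {q = q} {s} refl C≡1 2q≡ 2s≡ = begin
  + 2 * (q * x ^ 3 + s * (w + x) ^ 3)                                                ≡⟨ distribute q s (x ^ 3) ((w + x) ^ 3) ⟩
  (+ 2 * q) * x ^ 3 + (+ 2 * s) * (w + x) ^ 3                                        ≡⟨ cong₂ (λ a b → a * x ^ 3 + b * (w + x) ^ 3) 2q≡ 2s≡ ⟩
  (altCubePotential x (w + x) - + 1) * x ^ 3 + (cubePotential w x - + 1) * (w + x) ^ 3 ≡⟨ firstIdentity-polynomial w x C≡1 ⟩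
  (x ^ 3 - + 1) * ((w + x) ^ 3 - + 1)                                                ∎
  where
  distribute : ∀ q s X Y → + 2 * (q * X + s * Y) ≡ (+ 2 * q) * X + (+ 2 * s) * Y
  distribute = solve-∀

secondIdentity-algebraic : ∀ w x {y p s} → y ≡ w + x → cassiniForm w x ≡ -1ℤ →
  + 2 * p ≡ - altCubePotential x y + + 1 → + 2 * s ≡ cubePotential w x - + 1 →
  + 2 * (+ 1 + (p - + 1) * x ^ 3 + s * y ^ 3) ≡ (x ^ 3 - + 1) * (y ^ 3 - + 1)
secondIdentity-algebraic w x {p = p} {s} refl C≡-1 2p≡ 2s≡ = begin
  + 2 * (+ 1 + (p - + 1) * x ^ 3 + s * (w + x) ^ 3)                                              ≡⟨ distribute p s (x ^ 3) ((w + x) ^ 3) ⟩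
  + 2 + (+ 2 * p - + 2) * x ^ 3 + (+ 2 * s) * (w + x) ^ 3                                        ≡⟨ cong₂ (λ a b → + 2 + (a - + 2) * x ^ 3 + b * (w + x) ^ 3) 2p≡ 2s≡ ⟩
  + 2 + (- altCubePotential x (w + x) + + 1 - + 2) * x ^ 3 + (cubePotential w x - + 1) * (w + x) ^ 3 ≡⟨ secondIdentity-polynomial w x C≡-1 ⟩
  (x ^ 3 - + 1) * ((w + x) ^ 3 - + 1)                                                            ∎
  where
  distribute : ∀ p s X Y → + 2 * (+ 1 + (p - + 1) * X + s * Y) ≡ + 2 + (+ 2 * p - + 2) * X + (+ 2 * s) * Y
  distribute = solve-∀

firstIdentity : ∀ t → 1 ≤ t → sgn t ≡ + 1 →
  + 2 * ((∑[ 1 , suc t ] (λ k → sgn (k ∸ 1) * F k ^ 3)) * F (suc t) ^ 3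
         + (∑[ 2 , t ] (λ k → F k ^ 3)) * F (suc (suc t)) ^ 3)
    ≡ (F (suc t) ^ 3 - + 1) * (F (suc (suc t)) ^ 3 - + 1)
firstIdentity (suc n) _ t-even =
  firstIdentity-algebraic (F (suc n)) (F (suc (suc n))) (F-suc-suc (suc n)) (trans (cassini (suc n)) t-even)
                          (altCubeSum (suc (suc n))) (cubeSum 1 n)

secondIdentity : ∀ t → sgn t ≡ + 1 →
  + 2 * (+ 1 + (∑[ 1 , suc (suc t) ] (λ k → sgn k * F k ^ 3) - + 1) * F (suc (suc t)) ^ 3
         + (∑[ 2 , suc t ] (λ k → F k ^ 3)) * F (suc (suc t) Data.Nat.+ 1) ^ 3)
    ≡ (F (suc (suc t)) ^ 3 - + 1) * (F (suc (suc t) Data.Nat.+ 1) ^ 3 - + 1)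
secondIdentity t t-even rewrite +-comm t 1 =
  secondIdentity-algebraic (F (suc t)) (F (suc (suc t))) (F-suc-suc (suc t)) (trans (cassini (suc t)) (cong -_ t-even))
                           (signedCubeSum (suc (suc t))) (cubeSum 1 t)

theorem1p5 : (m : ℕ) → 2 ≤ m →
    (+ 2 * ((∑[ 1 , 2 Data.Nat.* m ∸ 1 ] (λ k → sgn (k ∸ 1) * F k ^ 3)) * F (2 Data.Nat.* m ∸ 1) ^ 3
            + (∑[ 2 , 2 Data.Nat.* m ∸ 2 ] (λ k → F k ^ 3)) * F (2 Data.Nat.* m) ^ 3)
      ≡ (F (2 Data.Nat.* m ∸ 1) ^ 3 - + 1) * (F (2 Data.Nat.* m) ^ 3 - + 1))
    ×
    (+ 2 * (+ 1 + (∑[ 1 , 2 Data.Nat.* m ] (λ k → sgn k * F k ^ 3) - + 1) * F (2 Data.Nat.* m) ^ 3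
            + (∑[ 2 , 2 Data.Nat.* m ∸ 1 ] (λ k → F k ^ 3)) * F (2 Data.Nat.* m Data.Nat.+ 1) ^ 3)
      ≡ (F (2 Data.Nat.* m) ^ 3 - + 1) * (F (2 Data.Nat.* m Data.Nat.+ 1) ^ 3 - + 1))
theorem1p5 m@(suc (suc _)) 2≤m@(s≤s (s≤s _)) = firstIdentity t 1≤t t-even , secondIdentity t t-even
  where
  t = 2 Data.Nat.* m ∸ 2
  t-even : sgn t ≡ + 1
  t-even = trans (cong sgn (sym (*-distribˡ-∸ 2 m 1))) (sgn-even (m ∸ 1))
  1≤t : 1 ≤ t
  1≤t = ≤-trans (s≤s z≤n) (∸-monoˡ-≤ 2 (*-monoʳ-≤ 2 2≤m))
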